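{- Let $0<q<1$, let $B_{0,q},B_{1,q},\dots\in\mathbb{R}$ with $B_{0,q}\ne0$, and define $A_{0,q}(x)=1/B_{0,q}$ and, for $n\ge1$, $A_{n,q}(x)=\frac{(-1)^n}{B_{0,q}^{n+1}}\det N_n(x)$, where $N_n(x)$ is the $(n+1)\times(n+1)$ matrix with rows and columns indexed by $r,c\in\{0,\dots,n\}$, row $0$ equal to $(1,x,\dots,x^n)$, and entry in row $r\ge1$, column $c$ equal to $\left[\begin{smallmatrix} c\\ r-1\end{smallmatrix}\right]_qB_{c-r+1,q}$ if $c\ge r-1$ and $0$ otherwise. Then for every $n\ge1$, \[ A_{n,q}(x)=\frac{1}{B_{0,q}}\Big(x^n-\sum_{k=0}^{n-1}\left[\begin{smallmatrix} n\\ k\end{smallmatrix}\right]_qB_{n-k,q}A_{k,q}(x)\Big). \]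
   Context: $[n]_q=\frac{1-q^n}{1-q}$, $[n]_q!=[1]_q\cdots[n]_q$ with $[0]_q!=1$, and $\left[\begin{smallmatrix} n\\ k\end{smallmatrix}\right]_q=\frac{[n]_q!}{[k]_q![n-k]_q!}$. -}

module Defs where

open import Level using (Level)
open import Algebra.Bundles using (CommutativeRing)
open import Data.Nat using (ℕ; zero; suc; _∸_; _≤?_)
open import Data.Fin using (Fin; zero; suc; toℕ; punchIn)
open import Relation.Nullary using (yes; no)

-- Definitions over a commutative ring R equipped with an inverse operation _⁻¹
-- (the theorem assumes x * x ⁻¹ ≈ 1 for x ≉ 0, i.e. R is a field).
module QDefs {c ℓ : Level} (R : CommutativeRing c ℓ) (_⁻¹ : CommutativeRing.Carrier R → CommutativeRing.Carrier R) where
  open CommutativeRing R hiding (zero)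

  pow : Carrier → ℕ → Carrier
  pow x zero = 1#
  pow x (suc n) = x * pow x n

  ΣFin : (n : ℕ) → (Fin n → Carrier) → Carrier
  ΣFin zero f = 0#
  ΣFin (suc n) f = f zero + ΣFin n (λ i → f (suc i))

  Σ< : ℕ → (ℕ → Carrier) → Carrier
  Σ< n f = ΣFin n (λ i → f (toℕ i))

  sgn : ℕ → Carrier
  sgn n = pow (- 1#) n

  det : (n : ℕ) → (Fin n → Fin n → Carrier) → Carrier
  det zero M = 1#
  det (suc n) M = ΣFin (suc n) (λ j → sgn (toℕ j) * (M zero j * det n (λ r c' → M (suc r) (punchIn j c'))))

  qnum : Carrier → ℕ → Carrier
  qnum q n = (1# - pow q n) * ((1# - q) ⁻¹)

  qfact : Carrier → ℕ → Carrier
  qfact q zero = 1#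
  qfact q (suc n) = qfact q n * qnum q (suc n)

  -- [n choose k]_q = [n]! / ([k]! [n-k]!)  (only used for k ≤ n)
  qbinom : Carrier → ℕ → ℕ → Carrier
  qbinom q n k = qfact q n * ((qfact q k * qfact q (n ∸ k)) ⁻¹)

  Nmat : Carrier → (ℕ → Carrier) → Carrier → (n : ℕ) → Fin (suc n) → Fin (suc n) → Carrier
  Nmat q B x n zero col = pow x (toℕ col)
  Nmat q B x n (suc r) col with toℕ r ≤? toℕ col
  ... | yes _ = qbinom q (toℕ col) (toℕ r) * B (toℕ col ∸ toℕ r)
  ... | no _ = 0#

  A : Carrier → (ℕ → Carrier) → ℕ → Carrier → Carrier
  A q B zero x = B 0 ⁻¹
  A q B (suc m) x = sgn (suc m) * (pow (B 0 ⁻¹) (suc (suc m)) * det (suc (suc m)) (Nmat q B x (suc m)))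

{-# OPTIONS --safe #-}
-- Expand det N_n along its last column. Deleting row 0 and the last column leaves a matrix whose
-- rows vanish left of the diagonal and carry B₀ on it, so that cofactor is B₀ⁿ and the term gives
-- xⁿ. Deleting row k+1 leaves N_k on top of such a triangular block, so that cofactor is
-- B₀^(n-k-1) det N_k = ± B₀ⁿ A_k, which yields the k-th summand. The hypothesis on q only serves to
-- make the q-factorials invertible, so that [r choose r]_q = 1 and the diagonal entries are B₀.
module Submission where

open import Defs
open import Level using (Level)
open import Algebra.Bundles using (CommutativeRing)
open import Data.Nat as ℕ using (ℕ; zero; suc; _∸_; _≤_; _<_; _≤?_; z≤n; s≤s)
import Data.Nat.Properties as ℕ
open import Data.Fin using (Fin; zero; suc; toℕ; punchIn; inject₁; fromℕ)
open import Data.Fin.Properties using (toℕ-fromℕ; toℕ-inject₁; toℕ<n)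
open import Function using (_∘_)
open import Relation.Binary.PropositionalEquality as ≡ using (_≡_)
open import Relation.Nullary using (¬_; yes; no; contradiction)

punchIn-fromℕ : ∀ {n} (j : Fin n) → punchIn (fromℕ n) j ≡ inject₁ j
punchIn-fromℕ zero = ≡.refl
punchIn-fromℕ (suc j) = ≡.cong suc (punchIn-fromℕ j)

punchIn-inject₁-fromℕ : ∀ {n} (i : Fin (suc n)) → punchIn (inject₁ i) (fromℕ n) ≡ fromℕ (suc n)
punchIn-inject₁-fromℕ {n} zero = ≡.refl
punchIn-inject₁-fromℕ {suc n} (suc i) = ≡.cong suc (punchIn-inject₁-fromℕ i)

punchIn-inject₁ : ∀ {n} (i : Fin (suc n)) (j : Fin n) → punchIn (inject₁ i) (inject₁ j) ≡ inject₁ (punchIn i j)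
punchIn-inject₁ zero j = ≡.refl
punchIn-inject₁ (suc i) zero = ≡.refl
punchIn-inject₁ (suc i) (suc j) = ≡.cong suc (punchIn-inject₁ i j)

punchInℕ : ℕ → ℕ → ℕ
punchInℕ zero r = suc r
punchInℕ (suc i) zero = zero
punchInℕ (suc i) (suc r) = suc (punchInℕ i r)

toℕ-punchIn : ∀ {n} (i : Fin (suc n)) (r : Fin n) → toℕ (punchIn i r) ≡ punchInℕ (toℕ i) (toℕ r)
toℕ-punchIn zero r = ≡.refl
toℕ-punchIn (suc i) zero = ≡.refl
toℕ-punchIn (suc i) (suc r) = ≡.cong suc (toℕ-punchIn i r)

punchInℕ-< : ∀ {i r} → r < i → punchInℕ i r ≡ r
punchInℕ-< {suc i} {zero} _ = ≡.refl
punchInℕ-< {suc i} {suc r} (s≤s r<i) = ≡.cong suc (punchInℕ-< r<i)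

punchInℕ-≥ : ∀ {i r} → i ≤ r → punchInℕ i r ≡ suc r
punchInℕ-≥ {zero} _ = ≡.refl
punchInℕ-≥ {suc i} {suc r} (s≤s i≤r) = ≡.cong suc (punchInℕ-≥ i≤r)

module Determinant {c ℓ : Level} (R : CommutativeRing c ℓ)
  (_⁻¹ : CommutativeRing.Carrier R → CommutativeRing.Carrier R) where
  open CommutativeRing R hiding (zero)
  open QDefs R _⁻¹
  open import Algebra.Properties.Semiring.Sum semiring using (sum; ∑-comm; sum-init-last; *-distribˡ-sum)
  import Algebra.Properties.Ring ring as RingProperties
  open import Algebra.Solver.CommutativeMonoid *-commutativeMonoid using (solve; _⊕_; _⊜_)
  open import Relation.Binary.Reasoning.Setoid setoid

  ΣFin≈sum : ∀ n (f : Fin n → Carrier) → ΣFin n f ≈ sum f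
  ΣFin≈sum zero f = refl
  ΣFin≈sum (suc n) f = +-congˡ (ΣFin≈sum n (f ∘ suc))

  ΣFin-cong : ∀ n {f g : Fin n → Carrier} → (∀ i → f i ≈ g i) → ΣFin n f ≈ ΣFin n g
  ΣFin-cong zero f≈g = refl
  ΣFin-cong (suc n) f≈g = +-cong (f≈g zero) (ΣFin-cong n (f≈g ∘ suc))

  ΣFin-zeros : ∀ n {f : Fin n → Carrier} → (∀ i → f i ≈ 0#) → ΣFin n f ≈ 0#
  ΣFin-zeros zero f≈0 = refl
  ΣFin-zeros (suc n) f≈0 = trans (+-cong (f≈0 zero) (ΣFin-zeros n (f≈0 ∘ suc))) (+-identityˡ 0#)

  *-distribˡ-ΣFin : ∀ n a (f : Fin n → Carrier) → a * ΣFin n f ≈ ΣFin n (λ i → a * f i)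
  *-distribˡ-ΣFin n a f = begin
    a * ΣFin n f               ≈⟨ *-congˡ (ΣFin≈sum n f) ⟩
    a * sum f                  ≈⟨ *-distribˡ-sum a f ⟩
    sum (λ i → a * f i)        ≈⟨ ΣFin≈sum n _ ⟨
    ΣFin n (λ i → a * f i)     ∎

  ΣFin-comm : ∀ m n (f : Fin m → Fin n → Carrier) →
    ΣFin m (λ i → ΣFin n (f i)) ≈ ΣFin n (λ j → ΣFin m (λ i → f i j))
  ΣFin-comm m n f = begin
    ΣFin m (λ i → ΣFin n (f i))                ≈⟨ ΣFin-cong m (λ i → ΣFin≈sum n (f i)) ⟩
    ΣFin m (λ i → sum (f i))                   ≈⟨ ΣFin≈sum m _ ⟩
    sum (λ i → sum (f i))                      ≈⟨ ∑-comm f ⟩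
    sum (λ j → sum (λ i → f i j))              ≈⟨ ΣFin≈sum n _ ⟨
    ΣFin n (λ j → sum (λ i → f i j))           ≈⟨ ΣFin-cong n (λ j → ΣFin≈sum m _) ⟨
    ΣFin n (λ j → ΣFin m (λ i → f i j))        ∎

  ΣFin-init-last : ∀ n (f : Fin (suc n) → Carrier) → ΣFin (suc n) f ≈ ΣFin n (f ∘ inject₁) + f (fromℕ n)
  ΣFin-init-last n f = begin
    ΣFin (suc n) f                     ≈⟨ ΣFin≈sum (suc n) f ⟩
    sum f                              ≈⟨ sum-init-last f ⟩
    sum (f ∘ inject₁) + f (fromℕ n)    ≈⟨ +-congʳ (ΣFin≈sum n _) ⟨
    ΣFin n (f ∘ inject₁) + f (fromℕ n) ∎

  pow-+ : ∀ y m n → pow y (m ℕ.+ n) ≈ pow y m * pow y n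
  pow-+ y zero n = sym (*-identityˡ _)
  pow-+ y (suc m) n = trans (*-congˡ (pow-+ y m n)) (sym (*-assoc _ _ _))

  pow-cancel : ∀ {y z} → y * z ≈ 1# → ∀ n → pow y n * pow z n ≈ 1#
  pow-cancel yz≈1 zero = *-identityˡ 1#
  pow-cancel {y} {z} yz≈1 (suc n) = begin
    (y * pow y n) * (z * pow z n)
      ≈⟨ solve 4 (λ a b c d → (a ⊕ b) ⊕ (c ⊕ d) ⊜ (a ⊕ c) ⊕ (b ⊕ d)) refl y (pow y n) z (pow z n) ⟩
    (y * z) * (pow y n * pow z n)
      ≈⟨ *-cong yz≈1 (pow-cancel yz≈1 n) ⟩
    1# * 1#
      ≈⟨ *-identityˡ 1# ⟩
    1# ∎

  -1*-1≈1 : - 1# * - 1# ≈ 1#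
  -1*-1≈1 = trans (RingProperties.-1*x≈-x (- 1#)) (RingProperties.-‿involutive 1#)

  sgn-+ : ∀ m n → sgn (m ℕ.+ n) ≈ sgn m * sgn n
  sgn-+ = pow-+ (- 1#)

  sgn-square : ∀ n → sgn n * sgn n ≈ 1#
  sgn-square = pow-cancel -1*-1≈1

  sgn-double : ∀ n → sgn (n ℕ.+ n) ≈ 1#
  sgn-double n = trans (sgn-+ n n) (sgn-square n)

  sgn-suc-suc : ∀ n → sgn (suc (suc n)) ≈ sgn n
  sgn-suc-suc n = trans (sym (*-assoc _ _ _)) (trans (*-congʳ -1*-1≈1) (*-identityˡ _))

  Matrix : ℕ → Set c
  Matrix n = Fin n → Fin n → Carrier

  minor : ∀ {n} → Matrix (suc n) → Fin (suc n) → Fin (suc n) → Matrix n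
  minor M i j r c = M (punchIn i r) (punchIn j c)

  firstRowTerm : ∀ {n} → Matrix (suc n) → Fin (suc n) → Carrier
  firstRowTerm {n} M j = sgn (toℕ j) * (M zero j * det n (minor M zero j))

  det-cong : ∀ n {M M′ : Matrix n} → (∀ r c → M r c ≈ M′ r c) → det n M ≈ det n M′
  det-cong zero M≈M′ = refl
  det-cong (suc n) {M} {M′} M≈M′ = ΣFin-cong (suc n) {firstRowTerm M} {firstRowTerm M′} λ j →
    *-congˡ (*-cong (M≈M′ zero j) (det-cong n (λ r c → M≈M′ (suc r) (punchIn j c))))

  det-zeroRow : ∀ n (M : Matrix n) (i : Fin n) → (∀ c → M i c ≈ 0#) → det n M ≈ 0#
  det-zeroRow (suc n) M zero Mi≈0 = ΣFin-zeros (suc n) {firstRowTerm M} λ j →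
    trans (*-congˡ (trans (*-congʳ (Mi≈0 j)) (zeroˡ _))) (zeroʳ _)
  det-zeroRow (suc n) M (suc i) Mi≈0 = ΣFin-zeros (suc n) {firstRowTerm M} λ j →
    trans (*-congˡ (trans (*-congˡ (det-zeroRow n (minor M zero j) i (Mi≈0 ∘ punchIn j))) (zeroʳ _))) (zeroʳ _)

  lastColumnTerm : ∀ {n} → Matrix (suc n) → Fin (suc n) → Carrier
  lastColumnTerm {n} M i = sgn (toℕ i ℕ.+ n) * (M i (fromℕ n) * det n (minor M i (fromℕ n)))

  -- Expand along the first row, then every first-row minor along its last column (induction),
  -- and regroup the resulting double sum by rows: the inner sums are first-row expansions again.
  det-expandLastColumn : ∀ n (M : Matrix (suc n)) → det (suc n) M ≈ ΣFin (suc n) (lastColumnTerm M)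
  det-expandLastColumn zero M = refl
  det-expandLastColumn (suc n) M = begin
    det (suc (suc n)) M
      ≈⟨ ΣFin-init-last (suc n) (firstRowTerm M) ⟩
    ΣFin (suc n) (firstRowTerm M ∘ inject₁) + firstRowTerm M last
      ≈⟨ +-comm _ _ ⟩
    firstRowTerm M last + ΣFin (suc n) (firstRowTerm M ∘ inject₁)
      ≈⟨ +-cong cornerTerm (ΣFin-cong (suc n) {firstRowTerm M ∘ inject₁} expandFirstRowTerm) ⟩
    lastColumnTerm M zero + ΣFin (suc n) (λ j → ΣFin (suc n) (λ i → X i j))
      ≈⟨ +-congˡ (ΣFin-comm (suc n) (suc n) (λ j i → X i j)) ⟩
    lastColumnTerm M zero + ΣFin (suc n) (λ i → ΣFin (suc n) (λ j → X i j))
      ≈⟨ +-congˡ (ΣFin-cong (suc n) {λ i → ΣFin (suc n) (X i)} {lastColumnTerm M ∘ suc}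
                                  (sym ∘ expandLastColumnTerm)) ⟩
    ΣFin (suc (suc n)) (lastColumnTerm M) ∎
    where
    last : Fin (suc (suc n))
    last = fromℕ (suc n)

    D : Fin (suc n) → Fin (suc n) → Carrier
    D i j = det n (λ r c → M (suc (punchIn i r)) (inject₁ (punchIn j c)))

    X : Fin (suc n) → Fin (suc n) → Carrier
    X i j = (sgn (toℕ i ℕ.+ n) * M (suc i) last) * (sgn (toℕ j) * (M zero (inject₁ j) * D i j))

    cornerTerm : firstRowTerm M last ≈ lastColumnTerm M zero
    cornerTerm = *-congʳ (reflexive (≡.cong sgn (toℕ-fromℕ (suc n))))

    expandFirstRowTerm : ∀ j → firstRowTerm M (inject₁ j) ≈ ΣFin (suc n) (λ i → X i j)
    expandFirstRowTerm j = begin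
      sgn (toℕ (inject₁ j)) * (a * det (suc n) Mʲ)
        ≈⟨ *-cong (reflexive (≡.cong sgn (toℕ-inject₁ j))) (*-congˡ (det-expandLastColumn n Mʲ)) ⟩
      sgn (toℕ j) * (a * ΣFin (suc n) (lastColumnTerm Mʲ))
        ≈⟨ *-congˡ (*-distribˡ-ΣFin (suc n) a (lastColumnTerm Mʲ)) ⟩
      sgn (toℕ j) * ΣFin (suc n) (λ i → a * lastColumnTerm Mʲ i)
        ≈⟨ *-distribˡ-ΣFin (suc n) (sgn (toℕ j)) (λ i → a * lastColumnTerm Mʲ i) ⟩
      ΣFin (suc n) (λ i → sgn (toℕ j) * (a * lastColumnTerm Mʲ i))
        ≈⟨ ΣFin-cong (suc n) {λ i → sgn (toℕ j) * (a * lastColumnTerm Mʲ i)} regroup ⟩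
      ΣFin (suc n) (λ i → X i j) ∎
      where
      a = M zero (inject₁ j)
      Mʲ = minor M zero (inject₁ j)

      columnTermOfMinor : ∀ i → lastColumnTerm Mʲ i ≈ sgn (toℕ i ℕ.+ n) * (M (suc i) last * D i j)
      columnTermOfMinor i = *-congˡ (*-cong (reflexive (≡.cong (M (suc i)) (punchIn-inject₁-fromℕ j)))
        (det-cong n λ r c → reflexive (≡.cong (M (suc (punchIn i r)))
          (≡.trans (≡.cong (punchIn (inject₁ j)) (punchIn-fromℕ c)) (punchIn-inject₁ j c)))))

      regroup : ∀ i → sgn (toℕ j) * (a * lastColumnTerm Mʲ i) ≈ X i j
      regroup i = trans (*-congˡ (*-congˡ (columnTermOfMinor i)))
        (solve 5 (λ s a s′ m d → s ⊕ (a ⊕ (s′ ⊕ (m ⊕ d))) ⊜ (s′ ⊕ m) ⊕ (s ⊕ (a ⊕ d)))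
                 refl (sgn (toℕ j)) a (sgn (toℕ i ℕ.+ n)) (M (suc i) last) (D i j))

    expandLastColumnTerm : ∀ i → lastColumnTerm M (suc i) ≈ ΣFin (suc n) (X i)
    expandLastColumnTerm i = begin
      sgn (suc (toℕ i ℕ.+ suc n)) * (M (suc i) last * det (suc n) Mᵢ)
        ≈⟨ *-congʳ (trans (reflexive (≡.cong (sgn ∘ suc) (ℕ.+-suc (toℕ i) n))) (sgn-suc-suc (toℕ i ℕ.+ n))) ⟩
      sgn (toℕ i ℕ.+ n) * (M (suc i) last * det (suc n) Mᵢ)
        ≈⟨ *-assoc _ _ _ ⟨
      (sgn (toℕ i ℕ.+ n) * M (suc i) last) * ΣFin (suc n) (firstRowTerm Mᵢ)
        ≈⟨ *-congˡ (ΣFin-cong (suc n) {firstRowTerm Mᵢ} rowTermOfMinor) ⟩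
      (sgn (toℕ i ℕ.+ n) * M (suc i) last) * ΣFin (suc n) (λ j → sgn (toℕ j) * (M zero (inject₁ j) * D i j))
        ≈⟨ *-distribˡ-ΣFin (suc n) _ (λ j → sgn (toℕ j) * (M zero (inject₁ j) * D i j)) ⟩
      ΣFin (suc n) (X i) ∎
      where
      Mᵢ = minor M (suc i) last

      rowTermOfMinor : ∀ j → firstRowTerm Mᵢ j ≈ sgn (toℕ j) * (M zero (inject₁ j) * D i j)
      rowTermOfMinor j = *-congˡ (*-cong (reflexive (≡.cong (M zero) (punchIn-fromℕ j)))
        (det-cong n λ r c → reflexive (≡.cong (M (suc (punchIn i r))) (punchIn-fromℕ (punchIn j c)))))

  det-lastRow : ∀ n (M : Matrix (suc n)) → (∀ c → M (fromℕ n) (inject₁ c) ≈ 0#) →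
    det (suc n) M ≈ M (fromℕ n) (fromℕ n) * det n (λ r c → M (inject₁ r) (inject₁ c))
  det-lastRow zero M _ = trans (+-identityʳ _) (*-identityˡ _)
  det-lastRow (suc n) M lastRow≈0 = begin
    det (suc (suc n)) M
      ≈⟨ det-expandLastColumn (suc n) M ⟩
    ΣFin (suc (suc n)) (lastColumnTerm M)
      ≈⟨ ΣFin-init-last (suc n) (lastColumnTerm M) ⟩
    ΣFin (suc n) (lastColumnTerm M ∘ inject₁) + lastColumnTerm M last
      ≈⟨ +-cong (ΣFin-zeros (suc n) {lastColumnTerm M ∘ inject₁} upperTerm≈0) cornerTerm ⟩
    0# + M last last * det (suc n) (λ r c → M (inject₁ r) (inject₁ c))
      ≈⟨ +-identityˡ _ ⟩
    M last last * det (suc n) (λ r c → M (inject₁ r) (inject₁ c)) ∎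
    where
    last : Fin (suc (suc n))
    last = fromℕ (suc n)

    upperTerm≈0 : ∀ j → lastColumnTerm M (inject₁ j) ≈ 0#
    upperTerm≈0 j = trans (*-congˡ (trans (*-congˡ minor≈0) (zeroʳ _))) (zeroʳ _)
      where
      minor≈0 : det (suc n) (minor M (inject₁ j) last) ≈ 0#
      minor≈0 = det-zeroRow (suc n) (minor M (inject₁ j) last) (fromℕ n) λ c →
        trans (reflexive (≡.cong₂ M (punchIn-inject₁-fromℕ j) (punchIn-fromℕ c))) (lastRow≈0 c)

    cornerTerm : lastColumnTerm M last ≈ M last last * det (suc n) (λ r c → M (inject₁ r) (inject₁ c))
    cornerTerm = begin
      sgn (toℕ last ℕ.+ suc n) * (M last last * det (suc n) (minor M last last))
        ≈⟨ *-cong (trans (reflexive (≡.cong (λ k → sgn (k ℕ.+ suc n)) (toℕ-fromℕ (suc n)))) (sgn-double (suc n)))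
                  (*-congˡ (det-cong (suc n) λ r c → reflexive (≡.cong₂ M (punchIn-fromℕ r) (punchIn-fromℕ c)))) ⟩
      1# * (M last last * det (suc n) (λ r c → M (inject₁ r) (inject₁ c)))
        ≈⟨ *-identityˡ _ ⟩
      M last last * det (suc n) (λ r c → M (inject₁ r) (inject₁ c)) ∎

module QFactorial {c ℓ : Level} (R : CommutativeRing c ℓ)
  (_⁻¹ : CommutativeRing.Carrier R → CommutativeRing.Carrier R) where
  open CommutativeRing R hiding (zero)
  open QDefs R _⁻¹
  import Algebra.Properties.Ring ring as RingProperties
  open import Relation.Binary.Reasoning.Setoid setoid

  -‿nonzero : ∀ {y z} → ¬ (y ≈ z) → ¬ (y - z ≈ 0#)
  -‿nonzero {y} {z} y≉z y-z≈0 = y≉z (RingProperties.x∙y⁻¹≈ε⇒x≈y y z y-z≈0)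

  module _ (*-inverseʳ : ∀ y → ¬ (y ≈ 0#) → y * (y ⁻¹) ≈ 1#) where

    *-nonzero : ∀ {y z} → ¬ (y ≈ 0#) → ¬ (z ≈ 0#) → ¬ (y * z ≈ 0#)
    *-nonzero {y} {z} y≉0 z≉0 yz≈0 = z≉0 (begin
      z                  ≈⟨ *-identityˡ z ⟨
      1# * z             ≈⟨ *-congʳ (*-inverseʳ y y≉0) ⟨
      (y * y ⁻¹) * z     ≈⟨ *-congʳ (*-comm y (y ⁻¹)) ⟩
      (y ⁻¹ * y) * z     ≈⟨ *-assoc _ _ _ ⟩
      y ⁻¹ * (y * z)     ≈⟨ *-congˡ yz≈0 ⟩
      y ⁻¹ * 0#          ≈⟨ zeroʳ _ ⟩
      0#                 ∎)

    ⁻¹-nonzero : ∀ {y} → ¬ (y ≈ 0#) → ¬ (y ⁻¹ ≈ 0#)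
    ⁻¹-nonzero {y} y≉0 y⁻¹≈0 = y≉0 (begin
      y              ≈⟨ *-identityʳ y ⟨
      y * 1#         ≈⟨ *-congˡ (*-inverseʳ y y≉0) ⟨
      y * (y * y ⁻¹) ≈⟨ *-congˡ (*-congˡ y⁻¹≈0) ⟩
      y * (y * 0#)   ≈⟨ *-congˡ (zeroʳ y) ⟩
      y * 0#         ≈⟨ zeroʳ y ⟩
      0#             ∎)

    module _ (q : Carrier) (qᵐ≉1 : ∀ m → 1 ≤ m → ¬ (pow q m ≈ 1#)) where
      q≉1 : ¬ (q ≈ 1#)
      q≉1 q≈1 = qᵐ≉1 1 (s≤s z≤n) (trans (*-identityʳ q) q≈1)

      1≉0 : ¬ (1# ≈ 0#)
      1≉0 1≈0 = q≉1 (trans (sym (*-identityʳ q)) (trans (*-congˡ 1≈0) (trans (zeroʳ q) (sym 1≈0))))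

      qnum-nonzero : ∀ m → 1 ≤ m → ¬ (qnum q m ≈ 0#)
      qnum-nonzero m 1≤m = *-nonzero (-‿nonzero (qᵐ≉1 m 1≤m ∘ sym)) (⁻¹-nonzero (-‿nonzero (q≉1 ∘ sym)))

      qfact-nonzero : ∀ n → ¬ (qfact q n ≈ 0#)
      qfact-nonzero zero = 1≉0
      qfact-nonzero (suc n) = *-nonzero (qfact-nonzero n) (qnum-nonzero (suc n) (s≤s z≤n))

      qbinom-diagonal : ∀ n → qbinom q n n ≈ 1#
      qbinom-diagonal n = begin
        qfact q n * (qfact q n * qfact q (n ∸ n)) ⁻¹  ≡⟨ ≡.cong (λ k → qfact q n * (qfact q n * qfact q k) ⁻¹) (ℕ.n∸n≡0 n) ⟩
        qfact q n * (qfact q n * 1#) ⁻¹              ≈⟨ *-congʳ (*-identityʳ _) ⟨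
        (qfact q n * 1#) * (qfact q n * 1#) ⁻¹       ≈⟨ *-inverseʳ _ (*-nonzero (qfact-nonzero n) 1≉0) ⟩
        1#                                           ∎

module Recurrence {c ℓ : Level} (R : CommutativeRing c ℓ)
  (_⁻¹ : CommutativeRing.Carrier R → CommutativeRing.Carrier R) where
  open CommutativeRing R hiding (zero)
  open QDefs R _⁻¹

  module _ (*-inverseʳ : ∀ y → ¬ (y ≈ 0#) → y * (y ⁻¹) ≈ 1#)
    (q : Carrier) (qᵐ≉1 : ∀ m → 1 ≤ m → ¬ (pow q m ≈ 1#))
    (B : ℕ → Carrier) (B₀≉0 : ¬ (B 0 ≈ 0#)) (x : Carrier) where
    open Determinant R _⁻¹
    open QFactorial R _⁻¹ using (qbinom-diagonal)
    import Algebra.Properties.Ring ring as RingProperties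
    open import Algebra.Solver.CommutativeMonoid *-commutativeMonoid using (solve; _⊕_; _⊜_)
    open import Relation.Binary.Reasoning.Setoid setoid

    -- Every N_n is the top-left corner of this infinite matrix.
    entry : ℕ → ℕ → Carrier
    entry zero c = pow x c
    entry (suc r) c with r ≤? c
    ... | yes _ = qbinom q c r * B (c ∸ r)
    ... | no  _ = 0#

    Nmat≡entry : ∀ n (r c : Fin (suc n)) → Nmat q B x n r c ≡ entry (toℕ r) (toℕ c)
    Nmat≡entry n zero c = ≡.refl
    Nmat≡entry n (suc r) c with toℕ r ≤? toℕ c
    ... | yes _ = ≡.refl
    ... | no  _ = ≡.refl

    entry-upper : ∀ {r c} → r ≤ c → entry (suc r) c ≡ qbinom q c r * B (c ∸ r)
    entry-upper {r} {c} r≤c with r ≤? c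
    ... | yes _ = ≡.refl
    ... | no r≰c = contradiction r≤c r≰c

    entry-lower : ∀ {r c} → c < r → entry (suc r) c ≡ 0#
    entry-lower {r} {c} c<r with r ≤? c
    ... | yes r≤c = contradiction r≤c (ℕ.<⇒≱ c<r)
    ... | no  _ = ≡.refl

    entry-diagonal : ∀ n → entry (suc n) n ≈ B 0
    entry-diagonal n = begin
      entry (suc n) n          ≡⟨ entry-upper (ℕ.≤-refl {n}) ⟩
      qbinom q n n * B (n ∸ n) ≈⟨ *-cong (qbinom-diagonal *-inverseʳ q qᵐ≉1 n) (reflexive (≡.cong B (ℕ.n∸n≡0 n))) ⟩
      1# * B 0                 ≈⟨ *-identityˡ (B 0) ⟩
      B 0                      ∎

    N : ∀ {n} → Matrix n
    N r c = entry (toℕ r) (toℕ c)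

    leadingMinor : ℕ → Carrier
    leadingMinor k = det k N

    withoutRow : ∀ {n} → ℕ → Matrix n
    withoutRow i r c = entry (punchInℕ i (toℕ r)) (toℕ c)

    -- From row i on, the rows are those of N shifted down by one: they vanish left of the diagonal
    -- and carry B 0 on it.
    det-withoutRow : ∀ i k → det (k ℕ.+ i) (withoutRow i) ≈ pow (B 0) k * leadingMinor i
    det-withoutRow i zero = begin
      det i (withoutRow i) ≈⟨ det-cong i (λ r c → reflexive (≡.cong (λ t → entry t (toℕ c)) (punchInℕ-< (toℕ<n r)))) ⟩
      leadingMinor i       ≈⟨ *-identityˡ _ ⟨
      1# * leadingMinor i  ∎
    det-withoutRow i (suc k) = begin
      det (suc n) (withoutRow i)
        ≈⟨ det-lastRow n (withoutRow i) lastRow≈0 ⟩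
      withoutRow i (fromℕ n) (fromℕ n) * det n (λ r c → withoutRow i (inject₁ r) (inject₁ c))
        ≈⟨ *-cong corner (det-cong n λ r c → reflexive (≡.cong₂ entry (≡.cong (punchInℕ i) (toℕ-inject₁ r)) (toℕ-inject₁ c))) ⟩
      B 0 * det n (withoutRow i)
        ≈⟨ *-congˡ (det-withoutRow i k) ⟩
      B 0 * (pow (B 0) k * leadingMinor i)
        ≈⟨ *-assoc _ _ _ ⟨
      pow (B 0) (suc k) * leadingMinor i ∎
      where
      n = k ℕ.+ i

      lastRowIndex : punchInℕ i (toℕ (fromℕ n)) ≡ suc n
      lastRowIndex = ≡.trans (≡.cong (punchInℕ i) (toℕ-fromℕ n)) (punchInℕ-≥ (ℕ.m≤n+m i k))

      lastRow≈0 : ∀ c → withoutRow i (fromℕ n) (inject₁ c) ≈ 0#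
      lastRow≈0 c = reflexive (≡.trans (≡.cong₂ entry lastRowIndex (toℕ-inject₁ c)) (entry-lower (toℕ<n c)))

      corner : withoutRow i (fromℕ n) (fromℕ n) ≈ B 0
      corner = trans (reflexive (≡.cong₂ entry lastRowIndex (toℕ-fromℕ n))) (entry-diagonal n)

    expansionTerm : ℕ → ℕ → Carrier
    expansionTerm n i = sgn (i ℕ.+ n) * (entry i n * (pow (B 0) (n ∸ i) * leadingMinor i))

    leadingMinor-expandLastColumn : ∀ n → leadingMinor (suc n) ≈ Σ< (suc n) (expansionTerm n)
    leadingMinor-expandLastColumn n = trans (det-expandLastColumn n N) (ΣFin-cong (suc n) {lastColumnTerm N} λ i →
      *-congˡ (*-cong (reflexive (≡.cong (entry (toℕ i)) (toℕ-fromℕ n))) (minor≈ i)))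
      where
      minor≈ : ∀ i → det n (minor N i (fromℕ n)) ≈ pow (B 0) (n ∸ toℕ i) * leadingMinor (toℕ i)
      minor≈ i = begin
        det n (minor N i (fromℕ n))
          ≈⟨ det-cong n (λ r c → reflexive (≡.cong₂ entry (toℕ-punchIn i r) (≡.trans (≡.cong toℕ (punchIn-fromℕ c)) (toℕ-inject₁ c)))) ⟩
        det n (withoutRow (toℕ i))
          ≡⟨ ≡.cong (λ m → det m (withoutRow (toℕ i))) (ℕ.m∸n+n≡m (ℕ.s≤s⁻¹ (toℕ<n i))) ⟨
        det (n ∸ toℕ i ℕ.+ toℕ i) (withoutRow (toℕ i))
          ≈⟨ det-withoutRow (toℕ i) (n ∸ toℕ i) ⟩
        pow (B 0) (n ∸ toℕ i) * leadingMinor (toℕ i) ∎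

    b : Carrier
    b = B 0 ⁻¹

    b*B₀≈1 : b * B 0 ≈ 1#
    b*B₀≈1 = trans (*-comm b (B 0)) (*-inverseʳ (B 0) B₀≉0)

    A≈leadingMinor : ∀ k → A q B k x ≈ sgn k * (pow b (suc k) * leadingMinor (suc k))
    A≈leadingMinor zero = sym (begin
      1# * ((b * 1#) * leadingMinor 1) ≈⟨ *-identityˡ _ ⟩
      (b * 1#) * leadingMinor 1        ≈⟨ *-cong (*-identityʳ b) (trans (+-identityʳ _) (trans (*-identityˡ _) (*-identityˡ 1#))) ⟩
      b * 1#                           ≈⟨ *-identityʳ b ⟩
      b                                ∎)
    A≈leadingMinor (suc k) = *-congˡ (*-congˡ (det-cong (suc (suc k)) λ r c → reflexive (Nmat≡entry (suc k) r c)))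

    leadingTerm : ∀ n → sgn n * (pow b (suc n) * expansionTerm n 0) ≈ b * pow x n
    leadingTerm n = begin
      sgn n * ((b * pow b n) * (sgn n * (pow x n * (pow (B 0) n * 1#))))
        ≈⟨ solve 6 (λ s b bⁿ xⁿ B₀ⁿ one → s ⊕ ((b ⊕ bⁿ) ⊕ (s ⊕ (xⁿ ⊕ (B₀ⁿ ⊕ one)))) ⊜ (s ⊕ s) ⊕ ((bⁿ ⊕ B₀ⁿ) ⊕ ((b ⊕ xⁿ) ⊕ one)))
                   refl (sgn n) b (pow b n) (pow x n) (pow (B 0) n) 1# ⟩
      (sgn n * sgn n) * ((pow b n * pow (B 0) n) * ((b * pow x n) * 1#))
        ≈⟨ *-cong (sgn-square n) (*-cong (pow-cancel b*B₀≈1 n) (*-identityʳ _)) ⟩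
      1# * (1# * (b * pow x n))
        ≈⟨ trans (*-identityˡ _) (*-identityˡ _) ⟩
      b * pow x n ∎

    -- b^(n+1) · B₀^(n-k-1) = b · b^(k+1) and (-1)^n (-1)^(k+1+n) = -(-1)^k, so the rest is the
    -- formula for A k.
    lowerTerm : ∀ n k → suc k ≤ n →
      sgn n * (pow b (suc n) * expansionTerm n (suc k)) ≈ - b * (qbinom q n k * (B (n ∸ k) * A q B k x))
    lowerTerm n k k<n = begin
      sgn n * (pow b (suc n) * (sgn (suc k ℕ.+ n) * (entry (suc k) n * (pow (B 0) e * leadingMinor (suc k)))))
        ≈⟨ *-congˡ (*-cong (*-congˡ bⁿ-split) (*-cong (sgn-+ (suc k) n) (*-congʳ (reflexive (entry-upper (ℕ.<⇒≤ k<n)))))) ⟩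
      s * ((b * (pow b e * bᵏ⁺¹)) * (((- 1# * sgn k) * s) * ((qbinom q n k * B (n ∸ k)) * (pow (B 0) e * Lᵏ⁺¹))))
        ≈⟨ solve 10 (λ s b bᵉ bᵏ⁺¹ m sᵏ qb Bₙₖ B₀ᵉ Lᵏ⁺¹ →
                      s ⊕ ((b ⊕ (bᵉ ⊕ bᵏ⁺¹)) ⊕ (((m ⊕ sᵏ) ⊕ s) ⊕ ((qb ⊕ Bₙₖ) ⊕ (B₀ᵉ ⊕ Lᵏ⁺¹))))
                      ⊜ (s ⊕ s) ⊕ ((bᵉ ⊕ B₀ᵉ) ⊕ ((m ⊕ b) ⊕ (qb ⊕ (Bₙₖ ⊕ (sᵏ ⊕ (bᵏ⁺¹ ⊕ Lᵏ⁺¹)))))))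
                   refl s b (pow b e) bᵏ⁺¹ (- 1#) (sgn k) (qbinom q n k) (B (n ∸ k)) (pow (B 0) e) Lᵏ⁺¹ ⟩
      (s * s) * ((pow b e * pow (B 0) e) * ((- 1# * b) * (qbinom q n k * (B (n ∸ k) * (sgn k * (bᵏ⁺¹ * Lᵏ⁺¹))))))
        ≈⟨ *-cong (sgn-square n) (*-cong (pow-cancel b*B₀≈1 e)
             (*-cong (RingProperties.-1*x≈-x b) (*-congˡ (*-congˡ (sym (A≈leadingMinor k)))))) ⟩
      1# * (1# * (- b * (qbinom q n k * (B (n ∸ k) * A q B k x))))
        ≈⟨ trans (*-identityˡ _) (*-identityˡ _) ⟩
      - b * (qbinom q n k * (B (n ∸ k) * A q B k x)) ∎
      where
      s = sgn n
      e = n ∸ suc k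
      bᵏ⁺¹ = pow b (suc k)
      Lᵏ⁺¹ = leadingMinor (suc k)
      bⁿ-split : pow b n ≈ pow b e * bᵏ⁺¹
      bⁿ-split = trans (reflexive (≡.cong (pow b) (≡.sym (ℕ.m∸n+n≡m k<n)))) (pow-+ b e (suc k))

    recurrence : ∀ n → A q B n x ≈ b * (pow x n - Σ< n (λ k → qbinom q n k * (B (n ∸ k) * A q B k x)))
    recurrence n = begin
      A q B n x
        ≈⟨ A≈leadingMinor n ⟩
      s * (bⁿ⁺¹ * leadingMinor (suc n))
        ≈⟨ *-congˡ (*-congˡ (leadingMinor-expandLastColumn n)) ⟩
      s * (bⁿ⁺¹ * (expansionTerm n 0 + Σ< n (expansionTerm n ∘ suc)))
        ≈⟨ trans (*-congˡ (distribˡ _ _ _)) (distribˡ _ _ _) ⟩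
      s * (bⁿ⁺¹ * expansionTerm n 0) + s * (bⁿ⁺¹ * Σ< n (expansionTerm n ∘ suc))
        ≈⟨ +-congˡ (trans (*-congˡ (*-distribˡ-ΣFin n _ _)) (*-distribˡ-ΣFin n _ _)) ⟩
      s * (bⁿ⁺¹ * expansionTerm n 0) + Σ< n (λ k → s * (bⁿ⁺¹ * expansionTerm n (suc k)))
        ≈⟨ +-cong (leadingTerm n) (ΣFin-cong n (λ i → lowerTerm n (toℕ i) (toℕ<n i))) ⟩
      b * pow x n + Σ< n (λ k → - b * f k)
        ≈⟨ +-congˡ (*-distribˡ-ΣFin n (- b) (f ∘ toℕ)) ⟨
      b * pow x n + - b * Σ< n f
        ≈⟨ +-congˡ (trans (sym (RingProperties.-‿distribˡ-* b _)) (RingProperties.-‿distribʳ-* b _)) ⟩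
      b * pow x n + b * - Σ< n f
        ≈⟨ distribˡ b _ _ ⟨
      b * (pow x n - Σ< n f) ∎
      where
      s = sgn n
      bⁿ⁺¹ = pow b (suc n)
      f : ℕ → Carrier
      f k = qbinom q n k * (B (n ∸ k) * A q B k x)

-- The recurrence holds for n = 0 as well.
mainTheorem7 : ∀ {c ℓ : Level} (R : CommutativeRing c ℓ)
  (_⁻¹ : CommutativeRing.Carrier R → CommutativeRing.Carrier R) →
  let open CommutativeRing R
      open QDefs R _⁻¹
  in (∀ y → ¬ (y ≈ 0#) → y * (y ⁻¹) ≈ 1#) →
     (q : Carrier) → (∀ m → 1 ≤ m → ¬ (pow q m ≈ 1#)) →
     (B : ℕ → Carrier) → ¬ (B 0 ≈ 0#) →
     (x : Carrier) → (n : ℕ) → 1 ≤ n →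
     A q B n x ≈ (B 0 ⁻¹) * (pow x n - Σ< n (λ k → qbinom q n k * (B (n ∸ k) * A q B k x)))
mainTheorem7 R _⁻¹ *-inverseʳ q qᵐ≉1 B B₀≉0 x n _ =
  Recurrence.recurrence R _⁻¹ *-inverseʳ q qᵐ≉1 B B₀≉0 x n
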